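{- Every theta, every closed theta, and every triangle-free wheel is a $2$-connected graph with no Hamiltonian cycle.
   Context: A Hamiltonian cycle of a graph $G$ is a (not necessarily induced) subgraph of $G$ which is a cycle containing every vertex of $G$. A theta is a graph consisting of two non-adjacent vertices $u,v$ (the ends) and three paths $P_1,P_2,P_3$ from $u$ to $v$, each of length at least two, such that the sets $V(P_i)\setminus\{u,v\}$ ($i=1,2,3$) are pairwise disjoint and there are no edges between any two of them (and no other edges). A closed theta is the graph obtained from a theta with ends $u,v$ by adding the edge $uv$. A wheel is the graph consisting of a cycle $W$ together with a vertex $v \notin V(W)$ having at least three neighbours in $W$, whose edges are the edges of $W$ and the edges from $v$ to its neighbours in $W$ (so $W$ is an induced cycle of the wheel). A graph is triangle-free if it contains no clique on three vertices. -}

module Defs where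

open import Data.Nat using (ℕ; _≤_)
open import Data.Fin using (Fin)
open import Data.List using (List; []; _∷_; _++_; length)
open import Data.List.Membership.Propositional using (_∈_; _∉_)
open import Data.List.Relation.Unary.Unique.Propositional using (Unique)
open import Data.Product using (Σ; _×_; ∃; ∃-syntax)
open import Data.Sum using (_⊎_)
open import Data.Empty using (⊥)
open import Data.Unit using (⊤)
open import Relation.Nullary using (¬_)
open import Relation.Binary.PropositionalEquality using (_≡_; _≢_)

record Graph (n : ℕ) : Set₁ where
  field
    Adj     : Fin n → Fin n → Set
    sym     : ∀ {x y} → Adj x y → Adj y x
    irrefl  : ∀ {x} → ¬ Adj x x
open Graph public

module _ {n : ℕ} where
  V : Set
  V = Fin n

  data Consec : List V → V → V → Set where
    here  : ∀ {x y zs} → Consec (x ∷ y ∷ zs) x y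
    there : ∀ {z xs x y} → Consec xs x y → Consec (z ∷ xs) x y

  ListEdge : List V → V → V → Set
  ListEdge P x y = Consec P x y ⊎ Consec P y x

  IsPath : Graph n → List V → Set
  IsPath G P = Unique P × (∀ x y → Consec P x y → Adj G x y)

  Disjoint : List V → List V → Set
  Disjoint A B = ∀ x → x ∈ A → x ∈ B → ⊥

  pathList : V → List V → V → List V
  pathList u I v = u ∷ I ++ (v ∷ [])

  cycleWalk : V → List V → List V
  cycleWalk c cs = c ∷ cs ++ (c ∷ [])

  CycleEdge : V → List V → V → V → Set
  CycleEdge c cs x y = ListEdge (cycleWalk c cs) x y

  -- a cycle (subgraph) of G: at least 3 distinct vertices, cyclically consecutive ones adjacent
  IsCycle : Graph n → V → List V → Set
  IsCycle G c cs = 2 ≤ length cs × Unique (c ∷ cs)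
                   × (∀ x y → Consec (cycleWalk c cs) x y → Adj G x y)

  Hamiltonian : Graph n → Set
  Hamiltonian G = Σ V λ c → Σ (List V) λ cs → IsCycle G c cs × (∀ x → x ∈ c ∷ cs)

  -- three u–v paths with interiors I₁ I₂ I₃, each of length ≥ 2, interiors pairwise
  -- disjoint, covering all vertices of G
  ThetaPaths : Graph n → V → V → List V → List V → List V → Set
  ThetaPaths G u v I₁ I₂ I₃ =
      IsPath G (pathList u I₁ v) × IsPath G (pathList u I₂ v) × IsPath G (pathList u I₃ v)
    × 1 ≤ length I₁ × 1 ≤ length I₂ × 1 ≤ length I₃
    × Disjoint I₁ I₂ × Disjoint I₁ I₃ × Disjoint I₂ I₃
    × (∀ x → x ≡ u ⊎ x ≡ v ⊎ x ∈ I₁ ⊎ x ∈ I₂ ⊎ x ∈ I₃)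

  PathsEdge : V → V → List V → List V → List V → V → V → Set
  PathsEdge u v I₁ I₂ I₃ x y =
    ListEdge (pathList u I₁ v) x y ⊎ ListEdge (pathList u I₂ v) x y ⊎ ListEdge (pathList u I₃ v) x y

  IsTheta : Graph n → Set
  IsTheta G = ∃[ u ] ∃[ v ] ∃[ I₁ ] ∃[ I₂ ] ∃[ I₃ ]
      ThetaPaths G u v I₁ I₂ I₃ × ¬ Adj G u v
    × (∀ x y → Adj G x y → PathsEdge u v I₁ I₂ I₃ x y)

  IsClosedTheta : Graph n → Set
  IsClosedTheta G = ∃[ u ] ∃[ v ] ∃[ I₁ ] ∃[ I₂ ] ∃[ I₃ ]
      ThetaPaths G u v I₁ I₂ I₃ × Adj G u v
    × (∀ x y → Adj G x y → PathsEdge u v I₁ I₂ I₃ x y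
                           ⊎ (x ≡ u × y ≡ v) ⊎ (x ≡ v × y ≡ u))

  IsWheel : Graph n → Set
  IsWheel G = ∃[ h ] ∃[ c ] ∃[ cs ]
      IsCycle G c cs × h ∉ c ∷ cs
    × (∀ x → x ≡ h ⊎ x ∈ c ∷ cs)
    × (∃[ a ] ∃[ b ] ∃[ d ] a ∈ c ∷ cs × b ∈ c ∷ cs × d ∈ c ∷ cs
         × a ≢ b × a ≢ d × b ≢ d × Adj G h a × Adj G h b × Adj G h d)
    × (∀ x y → Adj G x y → CycleEdge c cs x y
                          ⊎ (x ≡ h × y ∈ c ∷ cs) ⊎ (y ≡ h × x ∈ c ∷ cs))

  TriangleFree : Graph n → Set
  TriangleFree G = ∀ x y z → Adj G x y → Adj G y z → Adj G x z → ⊥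

  data Reach (G : Graph n) (P : V → Set) : V → V → Set where
    stay : ∀ {a} → P a → Reach G P a a
    step : ∀ {a b c} → P a → Adj G a b → Reach G P b c → Reach G P a c

  Connected : Graph n → Set
  Connected G = ∀ a b → Reach G (λ _ → ⊤) a b

  TwoConnected : Graph n → Set
  TwoConnected G = 3 ≤ n × Connected G
    × (∀ x a b → a ≢ x → b ≢ x → Reach G (λ y → y ≢ x) a b)

module Submission where

-- A vertex of degree two forces both of its edges into every Hamiltonian cycle, and no vertex
-- lies on three edges of a cycle. In a theta or closed theta, the first interior vertex of each
-- of the three paths has degree two, so a Hamiltonian cycle would use three edges at the end u.
-- In a triangle-free wheel, let the cycle leave the hub towards the rim vertex a: the two rim
-- neighbours of a are not adjacent to the hub, so they have degree two and force both rim edges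
-- at a, again three cycle edges at one vertex.
-- For 2-connectivity, after deleting any vertex x every remaining vertex is joined, avoiding x,
-- to one of two terminals (the ends of the theta; two consecutive rim vertices of the wheel),
-- and these are joined to each other avoiding x unless x is one of them.

open import Defs
open import Data.Nat using (ℕ; _≤_; s≤s)
open import Data.Fin using (Fin; zero; suc; _≟_)
open import Data.Fin.Properties using (injective⇒≤)
open import Data.List using (List; []; _∷_; _++_; length)
open import Data.List.Membership.Propositional using (_∈_; _∉_)
open import Data.List.Membership.Propositional.Properties using (∈-++⁻; ∈-++⁺ˡ; ∈-++⁺ʳ)
open import Data.List.Relation.Unary.Any using (here; there)
open import Data.List.Relation.Unary.All using ([]; _∷_)
open import Data.List.Relation.Unary.All.Properties using (All¬⇒¬Any; ++⁻ˡ)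
open import Data.List.Relation.Unary.AllPairs using ([]; _∷_)
import Data.List.Relation.Unary.AllPairs as AllPairs
open import Data.List.Relation.Unary.Unique.Propositional using (Unique)
open import Data.List.Relation.Unary.Unique.Propositional.Properties using (++⁺)
open import Data.Product using (_×_; _,_; ∃-syntax; proj₁; proj₂; map₂)
open import Data.Sum using (_⊎_; inj₁; inj₂; [_,_]′)
import Data.Sum as Sum
open import Data.Empty using (⊥; ⊥-elim)
open import Data.Unit using (tt)
open import Function using (id; _∘_; flip; Injective)
open import Relation.Nullary using (¬_; yes; no)
open import Relation.Binary.PropositionalEquality using (_≡_; _≢_; refl; subst; ≢-sym)
import Relation.Binary.PropositionalEquality as ≡

module _ {n : ℕ} where

  open import Data.List.Membership.DecPropositional (_≟_ {n}) using (_∈?_)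

  private variable
    a b e p x y y₁ y₂ y₃ z s q r₁ r₂ c c₁ : Fin n
    L M I J cs : List (Fin n)
    G : Graph n
    P Q : Fin n → Set

  head-∉ : Unique (a ∷ L) → a ∉ L
  head-∉ = All¬⇒¬Any ∘ AllPairs.head

  Unique-++⁻ˡ : ∀ L → Unique (L ++ M) → Unique L
  Unique-++⁻ˡ []      _         = []
  Unique-++⁻ˡ (_ ∷ L) (a∉ ∷ u) = ++⁻ˡ L a∉ ∷ Unique-++⁻ˡ L u

  Unique-rotate : Unique (c ∷ cs) → Unique (cs ++ c ∷ [])
  Unique-rotate u = ++⁺ (AllPairs.tail u) ([] ∷ []) λ { (m , here refl) → head-∉ u m }

  last-∉ : ∀ L → Unique (L ++ e ∷ []) → e ∉ L
  last-∉ (_ ∷ L) u (here refl) = head-∉ u (∈-++⁺ʳ L (here refl))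
  last-∉ (_ ∷ L) u (there m)   = last-∉ L (AllPairs.tail u) m

  rotate-∈ : x ∈ c ∷ cs → x ∈ cs ++ c ∷ []
  rotate-∈ {cs = cs} (here refl) = ∈-++⁺ʳ cs (here refl)
  rotate-∈           (there m)   = ∈-++⁺ˡ m

  cycleWalk-∈ : x ∈ cycleWalk c cs → x ∈ c ∷ cs
  cycleWalk-∈ (here refl) = here refl
  cycleWalk-∈ {cs = cs} (there m) with ∈-++⁻ cs m
  ... | inj₁ m′          = there m′
  ... | inj₂ (here refl) = here refl

  pathList-∈ : x ∈ pathList a I b → x ≡ a ⊎ x ∈ I ⊎ x ≡ b
  pathList-∈ (here eq) = inj₁ eq
  pathList-∈ {I = I} (there m) with ∈-++⁻ I m
  ... | inj₁ m′        = inj₂ (inj₁ m′)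
  ... | inj₂ (here eq) = inj₂ (inj₂ eq)

  ∉-pathList : x ∉ I → x ≢ a → x ≢ b → x ∉ pathList a I b
  ∉-pathList x∉I x≢a x≢b m = [ x≢a , [ x∉I , x≢b ]′ ]′ (pathList-∈ m)

  lastOf : Fin n → List (Fin n) → Fin n
  lastOf a []      = a
  lastOf _ (b ∷ L) = lastOf b L

  lastOf-snoc : ∀ a L e → lastOf a (L ++ e ∷ []) ≡ e
  lastOf-snoc _ []      _ = refl
  lastOf-snoc _ (b ∷ L) e = lastOf-snoc b L e

  Consec-lastOf : ∀ a L e → Consec (a ∷ L ++ e ∷ []) (lastOf a L) e
  Consec-lastOf _ []      _ = here
  Consec-lastOf _ (b ∷ L) e = there (Consec-lastOf b L e)

  Consec-∈ˡ : Consec L x y → x ∈ L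
  Consec-∈ˡ here      = here refl
  Consec-∈ˡ (there r) = there (Consec-∈ˡ r)

  Consec-∈ʳ : Consec L x y → y ∈ L
  Consec-∈ʳ here      = there (here refl)
  Consec-∈ʳ (there r) = there (Consec-∈ʳ r)

  Consec-∈-init : ∀ L → Consec (L ++ e ∷ []) x y → x ∈ L
  Consec-∈-init []          (there ())
  Consec-∈-init (_ ∷ [])    here      = here refl
  Consec-∈-init (_ ∷ _ ∷ _) here      = here refl
  Consec-∈-init (_ ∷ L)     (there r) = there (Consec-∈-init L r)

  Consec-∈-tail : Consec (a ∷ L) x y → y ∈ L
  Consec-∈-tail here      = here refl
  Consec-∈-tail (there r) = Consec-∈ʳ r

  Consec-++ : Consec L x y → Consec (L ++ M) x y
  Consec-++ here      = here
  Consec-++ (there r) = there (Consec-++ r)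

  ListEdge-∈ : ListEdge L x y → x ∈ L
  ListEdge-∈ = [ Consec-∈ˡ , Consec-∈ʳ ]′

  successor-unique : ∀ L → Unique (a ∷ L) → Consec (a ∷ L ++ e ∷ []) x y →
                     Consec (a ∷ L ++ e ∷ []) x y₁ → y ≡ y₁
  successor-unique []      _ here       here       = refl
  successor-unique []      _ here       (there (there ()))
  successor-unique []      _ (there (there ())) _
  successor-unique (_ ∷ _) _ here       here       = refl
  successor-unique (b ∷ L) u here       (there r)  = ⊥-elim (head-∉ u (Consec-∈-init (b ∷ L) r))
  successor-unique (b ∷ L) u (there r)  here       = ⊥-elim (head-∉ u (Consec-∈-init (b ∷ L) r))
  successor-unique (b ∷ L) u (there r)  (there r′) = successor-unique L (AllPairs.tail u) r r′

  predecessor-unique : Unique L → Consec (a ∷ L) y x → Consec (a ∷ L) y₁ x → y ≡ y₁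
  predecessor-unique _ here      here       = refl
  predecessor-unique u here      (there r)  = ⊥-elim (head-∉ u (Consec-∈-tail r))
  predecessor-unique u (there r) here       = ⊥-elim (head-∉ u (Consec-∈-tail r))
  predecessor-unique {L = _ ∷ _} u (there r) (there r′) = predecessor-unique (AllPairs.tail u) r r′

  -- A walk whose vertices are distinct apart from possibly its two ends: a path or a cycle.
  walk-neighbours : ∀ L → Unique (a ∷ L) → Unique (L ++ e ∷ []) →
                    Consec (a ∷ L ++ e ∷ []) x s → Consec (a ∷ L ++ e ∷ []) q x →
                    ListEdge (a ∷ L ++ e ∷ []) x z → z ≡ s ⊎ z ≡ q
  walk-neighbours L init _ xs _ (inj₁ xz) = inj₁ (successor-unique L init xz xs)
  walk-neighbours L _ tail _ qx (inj₂ zx) = inj₂ (predecessor-unique tail zx qx)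

  successor-exists : ∀ L → x ∈ L → ∃[ s ] Consec (L ++ e ∷ []) x s
  successor-exists {e = e} (_ ∷ [])    (here refl) = e , here
  successor-exists         (_ ∷ b ∷ _) (here refl) = b , here
  successor-exists         (_ ∷ L)     (there m)   = map₂ there (successor-exists L m)

  predecessor-exists : ∀ a L → x ∈ L → ∃[ q ] Consec (a ∷ L) q x
  predecessor-exists a (_ ∷ _) (here refl) = a , here
  predecessor-exists _ (b ∷ L) (there m)   = map₂ there (predecessor-exists b L m)

  unique-no-backtrack : Unique L → Consec L x y → Consec L y x → ⊥
  unique-no-backtrack u here      here       = head-∉ u (here refl)
  unique-no-backtrack u here      (there r)  = head-∉ u (Consec-∈ʳ r)
  unique-no-backtrack u (there r) here       = head-∉ u (Consec-∈ʳ r)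
  unique-no-backtrack u (there r) (there r′) = unique-no-backtrack (AllPairs.tail u) r r′

  cycle-successor : x ∈ c ∷ cs → ∃[ s ] Consec (cycleWalk c cs) x s
  cycle-successor {c = c} {cs = cs} = successor-exists (c ∷ cs)

  cycle-predecessor : x ∈ c ∷ cs → ∃[ q ] Consec (cycleWalk c cs) q x
  cycle-predecessor {c = c} {cs = cs} m = predecessor-exists c (cs ++ c ∷ []) (rotate-∈ m)

  cycle-successor-unique : Unique (c ∷ cs) →
                           Consec (cycleWalk c cs) x y → Consec (cycleWalk c cs) x y₁ → y ≡ y₁
  cycle-successor-unique {cs = cs} = successor-unique cs

  cycle-predecessor-unique : Unique (c ∷ cs) →
                             Consec (cycleWalk c cs) y x → Consec (cycleWalk c cs) y₁ x → y ≡ y₁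
  cycle-predecessor-unique = predecessor-unique ∘ Unique-rotate

  cycle-neighbours : Unique (c ∷ cs) → Consec (cycleWalk c cs) x s → Consec (cycleWalk c cs) q x →
                     CycleEdge c cs x z → z ≡ s ⊎ z ≡ q
  cycle-neighbours {cs = cs} u = walk-neighbours cs u (Unique-rotate u)

  cycle-no-backtrack : 2 ≤ length cs → Unique (c ∷ cs) →
                       Consec (cycleWalk c cs) x y → Consec (cycleWalk c cs) y x → ⊥
  cycle-no-backtrack {cs = []}         ()
  cycle-no-backtrack {cs = _ ∷ []}     (s≤s ())
  cycle-no-backtrack {cs = _ ∷ _ ∷ _}  _ u here      here       = head-∉ u (here refl)
  cycle-no-backtrack {cs = _ ∷ e ∷ es} _ u here      (there r)  =
    head-∉ u (there (here (successor-unique (e ∷ es) (AllPairs.tail u) r here)))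
  cycle-no-backtrack {cs = _ ∷ e ∷ es} _ u (there r) here       =
    head-∉ u (there (here (successor-unique (e ∷ es) (AllPairs.tail u) r here)))
  cycle-no-backtrack {cs = _ ∷ _ ∷ _}  _ u (there r) (there r′) =
    unique-no-backtrack (Unique-rotate u) r r′

  CycleEdge-sym : CycleEdge c cs x y → CycleEdge c cs y x
  CycleEdge-sym = Sum.swap

  CycleEdge-∈ : CycleEdge c cs x y → x ∈ c ∷ cs
  CycleEdge-∈ = cycleWalk-∈ ∘ ListEdge-∈

  CycleEdge-adj : IsCycle G c cs → CycleEdge c cs x y → Adj G x y
  CycleEdge-adj (_ , _ , adj) (inj₁ r) = adj _ _ r
  CycleEdge-adj {G = G} (_ , _ , adj) (inj₂ r) = sym G (adj _ _ r)

  no-three-CycleEdges : Unique (c ∷ cs) →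
                        CycleEdge c cs x y₁ → CycleEdge c cs x y₂ → CycleEdge c cs x y₃ →
                        y₁ ≢ y₂ → y₁ ≢ y₃ → y₂ ≢ y₃ → ⊥
  no-three-CycleEdges u (inj₁ e₁) (inj₁ e₂) _         d₁₂ _   _   = d₁₂ (cycle-successor-unique u e₁ e₂)
  no-three-CycleEdges u (inj₂ e₁) (inj₂ e₂) _         d₁₂ _   _   = d₁₂ (cycle-predecessor-unique u e₁ e₂)
  no-three-CycleEdges u (inj₁ e₁) (inj₂ _)  (inj₁ e₃) _   d₁₃ _   = d₁₃ (cycle-successor-unique u e₁ e₃)
  no-three-CycleEdges u (inj₁ _)  (inj₂ e₂) (inj₂ e₃) _   _   d₂₃ = d₂₃ (cycle-predecessor-unique u e₂ e₃)
  no-three-CycleEdges u (inj₂ _)  (inj₁ e₂) (inj₁ e₃) _   _   d₂₃ = d₂₃ (cycle-successor-unique u e₂ e₃)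
  no-three-CycleEdges u (inj₂ e₁) (inj₁ _)  (inj₂ e₃) _   d₁₃ _   = d₁₃ (cycle-predecessor-unique u e₁ e₃)

  -- The cycle's successor and predecessor of x are distinct neighbours of x, hence are y₁ and y₂.
  degree-two-CycleEdges : IsCycle G c cs → x ∈ c ∷ cs → (∀ z → Adj G x z → z ≡ y₁ ⊎ z ≡ y₂) →
                          CycleEdge c cs x y₁ × CycleEdge c cs x y₂
  degree-two-CycleEdges {G = G} (len , u , adj) m neighbours
    with cycle-successor m | cycle-predecessor m
  ... | s , x→s | q , q→x with neighbours s (adj _ _ x→s) | neighbours q (sym G (adj _ _ q→x))
  ... | inj₁ refl | inj₂ refl = inj₁ x→s , inj₂ q→x
  ... | inj₂ refl | inj₁ refl = inj₂ q→x , inj₁ x→s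
  ... | inj₁ refl | inj₁ refl = ⊥-elim (cycle-no-backtrack len u x→s q→x)
  ... | inj₂ refl | inj₂ refl = ⊥-elim (cycle-no-backtrack len u x→s q→x)

  -- Connectivity avoiding a vertex

  Reach-end : Reach G P a b → P b
  Reach-end (stay pa)    = pa
  Reach-end (step _ _ r) = Reach-end r

  Reach-snoc : Reach G P a b → P c → Adj G b c → Reach G P a c
  Reach-snoc (stay pa)       pc adj′ = step pa adj′ (stay pc)
  Reach-snoc (step pa adj r) pc adj′ = step pa adj (Reach-snoc r pc adj′)

  Reach-reverse : Reach G P a b → Reach G P b a
  Reach-reverse         (stay pa)       = stay pa
  Reach-reverse {G = G} (step pa adj r) = Reach-snoc (Reach-reverse r) pa (sym G adj)

  Reach-trans : Reach G P a b → Reach G P b c → Reach G P a c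
  Reach-trans (stay _)        r′ = r′
  Reach-trans (step pa adj r) r′ = step pa adj (Reach-trans r r′)

  Reach-weaken : (∀ {z} → P z → Q z) → Reach G P a b → Reach G Q a b
  Reach-weaken f (stay pa)       = stay (f pa)
  Reach-weaken f (step pa adj r) = step (f pa) adj (Reach-weaken f r)

  ReachAvoiding : Graph n → Fin n → Fin n → Fin n → Set
  ReachAvoiding G x = Reach G (_≢ x)

  ConnectedAvoiding : Graph n → Fin n → Set
  ConnectedAvoiding G x = ∀ a b → a ≢ x → b ≢ x → ReachAvoiding G x a b

  ReachAvoiding-¬target : ¬ ReachAvoiding G x a x
  ReachAvoiding-¬target r = Reach-end r refl

  ConnectedAvoiding-hub : (∀ y → y ≢ x → ReachAvoiding G x y c) → ConnectedAvoiding G x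
  ConnectedAvoiding-hub to-hub a b a≢x b≢x = Reach-trans (to-hub a a≢x) (Reach-reverse (to-hub b b≢x))

  ConnectedAvoiding-terminals : (∀ y → y ≢ x → ReachAvoiding G x y r₁ ⊎ ReachAvoiding G x y r₂) →
                                (r₁ ≢ x → r₂ ≢ x → ReachAvoiding G x r₁ r₂) → ConnectedAvoiding G x
  ConnectedAvoiding-terminals {x = x} {r₁ = r₁} {r₂ = r₂} to-terminal link with r₁ ≟ x | r₂ ≟ x
  ... | yes refl | _        =
    ConnectedAvoiding-hub λ y y≢x → [ ⊥-elim ∘ ReachAvoiding-¬target , id ]′ (to-terminal y y≢x)
  ... | no _     | yes refl =
    ConnectedAvoiding-hub λ y y≢x → [ id , ⊥-elim ∘ ReachAvoiding-¬target ]′ (to-terminal y y≢x)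
  ... | no r₁≢x  | no r₂≢x  =
    ConnectedAvoiding-hub λ y y≢x → [ (λ r → Reach-trans r (link r₁≢x r₂≢x)) , id ]′ (to-terminal y y≢x)

  Walk : Graph n → List (Fin n) → Set
  Walk G L = ∀ x y → Consec L x y → Adj G x y

  module _ {G : Graph n} where

    Walk-tail : Walk G (a ∷ L) → Walk G L
    Walk-tail w x y = w x y ∘ there

    walk-reaches-last : ∀ a L → Walk G (a ∷ L) → x ∉ a ∷ L → y ∈ a ∷ L →
                        ReachAvoiding G x y (lastOf a L)
    walk-reaches-last a []      _ x∉ (here refl) = stay λ { refl → x∉ (here refl) }
    walk-reaches-last a (b ∷ L) w x∉ (here refl) =
      step (λ { refl → x∉ (here refl) }) (w a b here)
        (walk-reaches-last b L (Walk-tail w) (x∉ ∘ there) (here refl))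
    walk-reaches-last a (b ∷ L) w x∉ (there m)   = walk-reaches-last b L (Walk-tail w) (x∉ ∘ there) m

    path-split : ∀ a L → Walk G (a ∷ L) → Unique (a ∷ L) → y ∈ a ∷ L → y ≢ x →
                 ReachAvoiding G x y a ⊎ ReachAvoiding G x y (lastOf a L)
    path-split a L       _ _ (here refl) y≢x = inj₁ (stay y≢x)
    path-split {x = x} a (b ∷ L) w u (there m) y≢x
      with path-split b L (Walk-tail w) (AllPairs.tail u) m y≢x
    ... | inj₂ r = inj₂ r
    ... | inj₁ r with a ≟ x
    ...   | no a≢x   = inj₁ (Reach-snoc r a≢x (sym G (w a b here)))
    ...   | yes refl = inj₂ (walk-reaches-last b L (Walk-tail w) (head-∉ u) m)

  distinct-triple⇒3≤n : p ≢ q → p ≢ r₁ → q ≢ r₁ → 3 ≤ n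
  distinct-triple⇒3≤n {p = p} {q = q} {r₁ = r} p≢q p≢r q≢r = injective⇒≤ {f = triple} injective
    where
    triple : Fin 3 → Fin n
    triple zero             = p
    triple (suc zero)       = q
    triple (suc (suc zero)) = r
    injective : Injective _≡_ _≡_ triple
    injective {zero}             {zero}             _  = refl
    injective {zero}             {suc zero}         eq = ⊥-elim (p≢q eq)
    injective {zero}             {suc (suc zero)}   eq = ⊥-elim (p≢r eq)
    injective {suc zero}         {zero}             eq = ⊥-elim (p≢q (≡.sym eq))
    injective {suc zero}         {suc zero}         _  = refl
    injective {suc zero}         {suc (suc zero)}   eq = ⊥-elim (q≢r eq)
    injective {suc (suc zero)}   {zero}             eq = ⊥-elim (p≢r (≡.sym eq))
    injective {suc (suc zero)}   {suc zero}         eq = ⊥-elim (q≢r (≡.sym eq))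
    injective {suc (suc zero)}   {suc (suc zero)}   _  = refl

  third-vertex : p ≢ q → p ≢ r₁ → q ≢ r₁ → ∀ a b → ∃[ x ] a ≢ x × b ≢ x
  third-vertex {p = p} {q = q} {r₁ = r} p≢q p≢r q≢r a b with a ≟ p | b ≟ p
  ... | no a≢p   | no b≢p   = p , a≢p , b≢p
  ... | yes refl | yes refl = q , p≢q , p≢q
  ... | yes refl | no _ with b ≟ q
  ...   | no b≢q   = q , p≢q , b≢q
  ...   | yes refl = r , p≢r , q≢r
  third-vertex {q = q} {r₁ = r} p≢q p≢r q≢r a b | no _ | yes refl with a ≟ q
  ...   | no a≢q   = q , a≢q , p≢q
  ...   | yes refl = r , q≢r , p≢r

  TwoConnected-intro : p ≢ q → p ≢ r₁ → q ≢ r₁ → (∀ x → ConnectedAvoiding G x) → TwoConnected G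
  TwoConnected-intro p≢q p≢r q≢r connected-avoiding =
      distinct-triple⇒3≤n p≢q p≢r q≢r
    , connected
    , connected-avoiding
    where
    connected : Connected _
    connected a b with third-vertex p≢q p≢r q≢r a b
    ... | x , a≢x , b≢x = Reach-weaken (λ _ → tt) (connected-avoiding x a b a≢x b≢x)

  -- Thetas

  nonempty-∈ : 1 ≤ length L → ∃[ x ] x ∈ L
  nonempty-∈ {L = x ∷ _} _ = x , here refl

  ends-distinct : Unique (pathList a I b) → a ≢ b
  ends-distinct {I = I} u refl = head-∉ u (∈-++⁺ʳ I (here refl))

  interior-≢start : Unique (pathList a I b) → x ∈ I → x ≢ a
  interior-≢start u m refl = head-∉ u (∈-++⁺ˡ m)

  interior-≢end : Unique (pathList a I b) → x ∈ I → x ≢ b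
  interior-≢end {I = I} u m refl = last-∉ I (AllPairs.tail u) m

  off-path : Unique (pathList a I b) → x ∈ I → x ∉ J → ¬ ListEdge (pathList a J b) x y
  off-path u m x∉J = ∉-pathList x∉J (interior-≢start u m) (interior-≢end u m) ∘ ListEdge-∈

  -- The second vertex p of the path has only two neighbours, so the cycle must use its edge to a.
  path-first-edge : IsCycle G c cs → p ∈ c ∷ cs → Unique (pathList a (p ∷ J) b) →
                    (∀ y → Adj G p y → ListEdge (pathList a (p ∷ J) b) p y) → CycleEdge c cs a p
  path-first-edge {G = G} {p = p} {a = a} {J = J} {b = b} cyc m u on-path
    with successor-exists {e = b} (a ∷ p ∷ J) (there (here refl))
  ... | s , p→s = CycleEdge-sym (proj₂ (degree-two-CycleEdges {G = G} cyc m neighbours))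
    where
    neighbours : ∀ y → Adj G p y → y ≡ s ⊎ y ≡ a
    neighbours y adj =
      walk-neighbours (p ∷ J) (Unique-++⁻ˡ (a ∷ p ∷ J) u) (AllPairs.tail u) p→s here (on-path y adj)

  -- Holds for thetas and closed thetas alike: the extra edge uv joins the two ends.
  InteriorEdgesOnPaths : Graph n → Fin n → Fin n → List (Fin n) → List (Fin n) → List (Fin n) → Set
  InteriorEdgesOnPaths G u v I₁ I₂ I₃ = ∀ x y → x ≢ u → x ≢ v → Adj G x y → PathsEdge u v I₁ I₂ I₃ x y

  module Theta {G : Graph n} {u v : Fin n} {I₁ I₂ I₃ : List (Fin n)}
    (P₁ : IsPath G (pathList u I₁ v)) (P₂ : IsPath G (pathList u I₂ v)) (P₃ : IsPath G (pathList u I₃ v))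
    (d₁₂ : Disjoint I₁ I₂) (d₁₃ : Disjoint I₁ I₃) (d₂₃ : Disjoint I₂ I₃)
    (interior-edges : InteriorEdgesOnPaths G u v I₁ I₂ I₃)
    where

    EdgesOnPath : List (Fin n) → Set
    EdgesOnPath I = ∀ {x} → x ∈ I → ∀ y → Adj G x y → ListEdge (pathList u I v) x y

    edge-at : IsPath G (pathList u I v) → x ∈ I → Adj G x y → PathsEdge u v I₁ I₂ I₃ x y
    edge-at (uq , _) m = interior-edges _ _ (interior-≢start uq m) (interior-≢end uq m)

    elsewhere : {A : Set} → IsPath G (pathList u I v) → x ∈ I → x ∉ J → ListEdge (pathList u J v) x y → A
    elsewhere (uq , _) m x∉J = ⊥-elim ∘ off-path uq m x∉J

    edges-on-path₁ : EdgesOnPath I₁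
    edges-on-path₁ m _ adj =
      [ id , [ elsewhere P₁ m (d₁₂ _ m) , elsewhere P₁ m (d₁₃ _ m) ]′ ]′ (edge-at P₁ m adj)

    edges-on-path₂ : EdgesOnPath I₂
    edges-on-path₂ m _ adj =
      [ elsewhere P₂ m (flip (d₁₂ _) m) , [ id , elsewhere P₂ m (d₂₃ _ m) ]′ ]′ (edge-at P₂ m adj)

    edges-on-path₃ : EdgesOnPath I₃
    edges-on-path₃ m _ adj =
      [ elsewhere P₃ m (flip (d₁₃ _) m) , [ elsewhere P₃ m (flip (d₂₃ _) m) , id ]′ ]′ (edge-at P₃ m adj)

    first-edge : IsCycle G c cs → (∀ x → x ∈ c ∷ cs) → IsPath G (pathList u I v) → 1 ≤ length I →
                 EdgesOnPath I → ∃[ p ] p ∈ I × CycleEdge c cs u p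
    first-edge {I = p ∷ _} cyc spanning (uq , _) _ on-path =
      p , here refl , path-first-edge {G = G} cyc (spanning p) uq (on-path (here refl))

    non-Hamiltonian : 1 ≤ length I₁ → 1 ≤ length I₂ → 1 ≤ length I₃ → ¬ Hamiltonian G
    non-Hamiltonian l₁ l₂ l₃ (c , cs , cyc , spanning)
      with first-edge cyc spanning P₁ l₁ edges-on-path₁
         | first-edge cyc spanning P₂ l₂ edges-on-path₂
         | first-edge cyc spanning P₃ l₃ edges-on-path₃
    ... | _ , m₁ , e₁ | _ , m₂ , e₂ | _ , m₃ , e₃ =
      no-three-CycleEdges (proj₁ (proj₂ cyc)) e₁ e₂ e₃
        (λ { refl → d₁₂ _ m₁ m₂ }) (λ { refl → d₁₃ _ m₁ m₃ }) (λ { refl → d₂₃ _ m₂ m₃ })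

    path-avoiding : IsPath G (pathList u I v) → x ∉ I → u ≢ x → v ≢ x → ReachAvoiding G x u v
    path-avoiding {I = I} (_ , w) x∉I u≢x v≢x =
      subst (ReachAvoiding G _ u) (lastOf-snoc u I v)
        (walk-reaches-last u (I ++ v ∷ []) w (∉-pathList x∉I (≢-sym u≢x) (≢-sym v≢x)) (here refl))

    ends-linked : u ≢ x → v ≢ x → ReachAvoiding G x u v
    ends-linked {x = x} u≢x v≢x with x ∈? I₁
    ... | no x∉I₁ = path-avoiding P₁ x∉I₁ u≢x v≢x
    ... | yes m   = path-avoiding P₂ (d₁₂ _ m) u≢x v≢x

    path-reaches-end : IsPath G (pathList u I v) → y ∈ I → y ≢ x →
                       ReachAvoiding G x y u ⊎ ReachAvoiding G x y v
    path-reaches-end {I = I} (uq , w) m y≢x =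
      Sum.map₂ (subst (ReachAvoiding G _ _) (lastOf-snoc u I v))
        (path-split u (I ++ v ∷ []) w uq (there (∈-++⁺ˡ m)) y≢x)

    two-connected : (∀ x → x ≡ u ⊎ x ≡ v ⊎ x ∈ I₁ ⊎ x ∈ I₂ ⊎ x ∈ I₃) → 1 ≤ length I₁ → TwoConnected G
    two-connected cover l₁ with nonempty-∈ l₁
    ... | _ , m =
      TwoConnected-intro (ends-distinct uq) (≢-sym (interior-≢start uq m)) (≢-sym (interior-≢end uq m))
        (λ _ → ConnectedAvoiding-terminals reaches-end ends-linked)
      where
      uq = proj₁ P₁

      reaches-end : ∀ y → y ≢ x → ReachAvoiding G x y u ⊎ ReachAvoiding G x y v
      reaches-end y y≢x with cover y
      ... | inj₁ refl                   = inj₁ (stay y≢x)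
      ... | inj₂ (inj₁ refl)            = inj₂ (stay y≢x)
      ... | inj₂ (inj₂ (inj₁ m))        = path-reaches-end P₁ m y≢x
      ... | inj₂ (inj₂ (inj₂ (inj₁ m))) = path-reaches-end P₂ m y≢x
      ... | inj₂ (inj₂ (inj₂ (inj₂ m))) = path-reaches-end P₃ m y≢x

  -- Wheels

  module Wheel {G : Graph n} {h c : Fin n} {cs : List (Fin n)}
    (cyc : IsCycle G c cs) (h∉ : h ∉ c ∷ cs) (cover : ∀ x → x ≡ h ⊎ x ∈ c ∷ cs)
    (edges : ∀ x y → Adj G x y → CycleEdge c cs x y ⊎ (x ≡ h × y ∈ c ∷ cs) ⊎ (y ≡ h × x ∈ c ∷ cs))
    where

    rim-unique : Unique (c ∷ cs)
    rim-unique = proj₁ (proj₂ cyc)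

    rim-walk : Walk G (cycleWalk c cs)
    rim-walk = proj₂ (proj₂ cyc)

    spoke-on-rim : Adj G h y → y ∈ c ∷ cs
    spoke-on-rim {y = y} adj with edges h y adj
    ... | inj₁ e                 = ⊥-elim (h∉ (CycleEdge-∈ e))
    ... | inj₂ (inj₁ (_ , m))    = m
    ... | inj₂ (inj₂ (refl , _)) = ⊥-elim (irrefl G adj)

    -- Triangle-freeness keeps the hub away from t, so t has degree two.
    forced-rim-edge : TriangleFree G → IsCycle G c₁ L → y ∈ c₁ ∷ L → Adj G h a → CycleEdge c cs a y →
                      CycleEdge c₁ L a y
    forced-rim-edge {y = t} {a = a} tf cyc′ t∈C ha a→t
      with cycle-successor (CycleEdge-∈ (CycleEdge-sym a→t))
         | cycle-predecessor (CycleEdge-∈ (CycleEdge-sym a→t))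
    ... | s , t→s | q , q→t =
      CycleEdge-sym (either (cycle-neighbours rim-unique t→s q→t (CycleEdge-sym a→t)))
      where
      rim-neighbours : ∀ z → Adj G t z → z ≡ s ⊎ z ≡ q
      rim-neighbours z adj with edges t z adj
      ... | inj₁ e                 = cycle-neighbours rim-unique t→s q→t e
      ... | inj₂ (inj₁ (refl , _)) = ⊥-elim (h∉ (CycleEdge-∈ (CycleEdge-sym a→t)))
      ... | inj₂ (inj₂ (refl , _)) = ⊥-elim (tf h a t ha (CycleEdge-adj {G = G} cyc a→t) (sym G adj))
      both = degree-two-CycleEdges {G = G} cyc′ t∈C rim-neighbours
      either : a ≡ s ⊎ a ≡ q → CycleEdge _ _ t a
      either (inj₁ refl) = proj₁ both
      either (inj₂ refl) = proj₂ both

    -- The cycle enters the hub from a rim vertex a, and must also use both rim edges at a.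
    non-Hamiltonian : TriangleFree G → ¬ Hamiltonian G
    non-Hamiltonian tf (c′ , cs′ , cyc′ , spanning) with cycle-successor (spanning h)
    ... | a , h→a = three-neighbours (cycle-successor a∈rim) (cycle-predecessor a∈rim)
      where
      ha : Adj G h a
      ha = CycleEdge-adj {G = G} cyc′ (inj₁ h→a)
      a∈rim : a ∈ c ∷ cs
      a∈rim = spoke-on-rim ha
      forced : CycleEdge c cs a z → CycleEdge c′ cs′ a z
      forced = forced-rim-edge tf cyc′ (spanning _) ha
      three-neighbours : ∃[ x ] Consec (cycleWalk c cs) a x → ∃[ y ] Consec (cycleWalk c cs) y a → ⊥
      three-neighbours (x , a→x) (y , y→a) =
        no-three-CycleEdges (proj₁ (proj₂ cyc′)) (inj₂ h→a) (forced (inj₁ a→x)) (forced (inj₂ y→a))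
          (λ { refl → h∉ (cycleWalk-∈ (Consec-∈ʳ a→x)) })
          (λ { refl → h∉ (cycleWalk-∈ (Consec-∈ˡ y→a)) })
          (λ { refl → cycle-no-backtrack (proj₁ cyc) rim-unique a→x y→a })

    rim-split : y ∈ c ∷ cs → y ≢ x → ReachAvoiding G x y c ⊎ ReachAvoiding G x y (lastOf c cs)
    rim-split = path-split c cs (λ x y → rim-walk x y ∘ Consec-++) rim-unique

    rim-linked : c ≢ x → lastOf c cs ≢ x → ReachAvoiding G x c (lastOf c cs)
    rim-linked c≢x ℓ≢x = step c≢x (sym G (rim-walk _ _ (Consec-lastOf c cs c))) (stay ℓ≢x)

    reaches-rim-end : a ∈ c ∷ cs → b ∈ c ∷ cs → a ≢ b → Adj G h a → Adj G h b →
                      ∀ y → y ≢ x → ReachAvoiding G x y c ⊎ ReachAvoiding G x y (lastOf c cs)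
    reaches-rim-end ma mb a≢b ha hb y y≢x with cover y
    ... | inj₂ m = rim-split m y≢x
    reaches-rim-end {a = a} {x = x} ma mb a≢b ha hb y y≢x | inj₁ refl with a ≟ x
    ... | no a≢x   = Sum.map (step y≢x ha) (step y≢x ha) (rim-split ma a≢x)
    ... | yes refl = Sum.map (step y≢x hb) (step y≢x hb) (rim-split mb (≢-sym a≢b))

ThetaPaths⇒TwoConnected×¬Hamiltonian : ∀ {n} {G : Graph n} {u v I₁ I₂ I₃} →
  ThetaPaths G u v I₁ I₂ I₃ → InteriorEdgesOnPaths G u v I₁ I₂ I₃ → TwoConnected G × ¬ Hamiltonian G
ThetaPaths⇒TwoConnected×¬Hamiltonian
  (P₁ , P₂ , P₃ , l₁ , l₂ , l₃ , d₁₂ , d₁₃ , d₂₃ , cover) interior-edges =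
  two-connected cover l₁ , non-Hamiltonian l₁ l₂ l₃
  where open Theta P₁ P₂ P₃ d₁₂ d₁₃ d₂₃ interior-edges

IsWheel⇒TwoConnected : ∀ {n} {G : Graph n} → IsWheel G → TwoConnected G
IsWheel⇒TwoConnected
  (_ , _ , _ , cyc , h∉ , cover , (_ , _ , _ , ma , mb , _ , a≢b , a≢d , b≢d , ha , hb , _) , edges) =
  TwoConnected-intro a≢b a≢d b≢d
    (λ _ → ConnectedAvoiding-terminals (reaches-rim-end ma mb a≢b ha hb) rim-linked)
  where open Wheel cyc h∉ cover edges

IsWheel⇒¬Hamiltonian : ∀ {n} {G : Graph n} → IsWheel G → TriangleFree G → ¬ Hamiltonian G
IsWheel⇒¬Hamiltonian {G = G} (_ , _ , _ , cyc , h∉ , cover , _ , edges) =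
  Wheel.non-Hamiltonian {G = G} cyc h∉ cover edges

lemma7 : ∀ {n : ℕ} (G : Graph n)
         → IsTheta G ⊎ IsClosedTheta G ⊎ (IsWheel G × TriangleFree G)
         → TwoConnected G × ¬ Hamiltonian G
lemma7 G (inj₁ (_ , _ , _ , _ , _ , paths , _ , edges)) =
  ThetaPaths⇒TwoConnected×¬Hamiltonian paths (λ x y _ _ → edges x y)
lemma7 G (inj₂ (inj₁ (_ , _ , _ , _ , _ , paths , _ , edges))) =
  ThetaPaths⇒TwoConnected×¬Hamiltonian paths λ x y x≢u x≢v adj →
    [ id , [ ⊥-elim ∘ x≢u ∘ proj₁ , ⊥-elim ∘ x≢v ∘ proj₁ ]′ ]′ (edges x y adj)
lemma7 G (inj₂ (inj₂ (wheel , triangle-free))) =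
  IsWheel⇒TwoConnected {G = G} wheel , IsWheel⇒¬Hamiltonian {G = G} wheel triangle-free
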